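{- Let $n\ge1$ and let $D=(d_1,\dots,d_k)$ be a sequence of integers. Then $D$ is the increasing lower degree sequence $D_1(\pi)$ for some partition $\pi$ of $[n]$ if and only if (1) $0=d_1\le d_2\le\cdots\le d_k$; (2) $d_{i+1}\le d_i+1$ for every $i\in[k-1]$; and (3) $n\ge k+d_k$.
   Context: For a partition $\pi$ of $[n]$ with blocks $X_1,\dots,X_k$ indexed so that $\min X_1<\cdots<\min X_k$, blocks $X_i,X_j$ overlap if neither $\max X_i<\min X_j$ nor $\max X_j<\min X_i$. The lower degree $d_i(\pi)$ is the number of $j<i$ such that $X_j$ overlaps $X_i$. The increasing lower degree sequence $D_1(\pi)$ is the multiset $\{d_1(\pi),\dots,d_k(\pi)\}$ written in non-decreasing order. -}

module Defs where

open import Data.Nat as ℕ using (ℕ; zero; suc; _⊓_; _⊔_)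
open import Data.Nat.Properties using () renaming (_<?_ to _<ℕ?_)
open import Data.Fin using (Fin; toℕ)
open import Data.Fin.Properties using () renaming (_≟_ to _≟F_)
open import Data.Integer as ℤ using (ℤ; +_)
open import Data.List using (List; []; _∷_; map; filter; length; foldr; last)
open import Data.List.Relation.Unary.Linked using (Linked)
open import Data.List.Relation.Binary.Permutation.Propositional using (_↭_)
open import Data.Maybe using (Maybe; just; nothing)
open import Data.Product using (Σ; _×_; ∃)
open import Relation.Binary.PropositionalEquality using (_≡_)
open import Relation.Nullary using (¬_)
open import Relation.Nullary.Decidable using (_×-dec_; ¬?)
open import Function.Definitions using (Surjective)

-- The list [0, 1, ..., n-1]; [n] = {1..n} is encoded 0-based by Fin n (order preserved).
allFin : (n : ℕ) → List (Fin n)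
allFin n = Data.List.allFin n

-- A set partition of [n]: k blocks, given by a surjective block-assignment map.
-- Block X_i = { x | block x ≡ i }; surjectivity = every block is nonempty.
record Partition (n : ℕ) : Set where
  field
    k         : ℕ
    block     : Fin n → Fin k
    surjective : Surjective _≡_ _≡_ block
open Partition public

elems : ∀ {n} (π : Partition n) → Fin (k π) → List ℕ
elems {n} π i = map toℕ (filter (λ x → block π x ≟F i) (allFin n))

minL : List ℕ → ℕ
minL []       = 0
minL (x ∷ xs) = foldr _⊓_ x xs

maxL : List ℕ → ℕ
maxL = foldr _⊔_ 0

minB maxB : ∀ {n} (π : Partition n) → Fin (k π) → ℕ
minB π i = minL (elems π i)
maxB π i = maxL (elems π i)

Overlap : ∀ {n} (π : Partition n) → Fin (k π) → Fin (k π) → Set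
Overlap π i j = ¬ (maxB π i ℕ.< minB π j) × ¬ (maxB π j ℕ.< minB π i)

lowerDeg : ∀ {n} (π : Partition n) → Fin (k π) → ℕ
lowerDeg π i = length (filter
  (λ j → (minB π j <ℕ? minB π i) ×-dec
         (¬? (maxB π i <ℕ? minB π j) ×-dec ¬? (maxB π j <ℕ? minB π i)))
  (allFin (k π)))

IsD₁ : ∀ {n} (π : Partition n) → List ℤ → Set
IsD₁ π D = Linked ℤ._≤_ D × (D ↭ map (λ i → + lowerDeg π i) (allFin (k π)))

Cond1 : List ℤ → Set
Cond1 D = Σ (List ℤ) (λ rest → D ≡ (+ 0) ∷ rest) × Linked ℤ._≤_ D

Cond2 : List ℤ → Set
Cond2 D = Linked (λ a b → b ℤ.≤ a ℤ.+ + 1) D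

Cond3 : ℕ → List ℤ → Set
Cond3 n D = ∀ dk → last D ≡ just dk → (+ length D) ℤ.+ dk ℤ.≤ + n

-- Elements are 0, …, n − 1. Call depth x the number of blocks X_j with min X_j < x ≤ max X_j;
-- then d_i = depth (min X_i). The depth is 0 at 0 and increases by at most one from x to x + 1,
-- and only when x is the minimum of a block, whose lower degree is then depth x. So every value
-- below a lower degree is a lower degree, and a sorted sequence containing 0 with this property
-- starts at 0 and has steps of at most one. The minima of all k blocks and the maxima of the
-- d_i blocks counted in depth (min X_i) are k + d_i distinct elements, so k + d_i ≤ n.
-- Conversely, for a valid sequence, blocks t = 0, …, k − 1 start at t; when d_{t+1} = d_t + 1
-- block t also receives the element k + d_t, and all other elements join the last block. Then
-- the blocks overlapping block i from below are exactly the t < i at which the sequence steps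
-- up, and there are d_i of them.

module Submission where

open import Level using (Level)
open import Defs
open import Data.Nat using (ℕ; zero; suc; _+_; _∸_; _≤_; _<_; z≤n; s≤s; s≤s⁻¹)
open import Data.Nat.Properties
open import Data.Integer as ℤ using (ℤ; +≤+) renaming (+_ to ofℕ)
open import Data.Integer.Properties as ℤ using (drop‿+≤+)
open import Data.Fin as Fin using (Fin; toℕ; fromℕ<)
open import Data.Fin.Properties using (toℕ-injective; toℕ-fromℕ<; toℕ<n; any?)
open import Data.List using (List; []; _∷_; map; filter; length; last; tabulate; upTo; _++_)
open import Data.List.Properties
  using (length-removeAt′; foldr-preservesᵒ; filter-≐; filter-none; length-++; length-map; length-tabulate;
         length-upTo; map-tabulate; tabulate-cong; map-∘; last-map)
open import Data.List.Membership.Propositional using (_∈_)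
open import Data.List.Membership.Propositional.Properties
  using (foldr-selective; ∈-map⁺; ∈-map⁻; ∈-filter⁺; ∈-filter⁻; ∈-allFin; ∈-upTo⁺; ∈-upTo⁻)
open import Data.List.Relation.Unary.Any as Any using (Any; here; there; _─_; index)
open import Data.List.Relation.Unary.All as All using (All; []; _∷_)
open import Data.List.Relation.Unary.AllPairs using (_∷_)
open import Data.List.Relation.Unary.Unique.Propositional using (Unique)
open import Data.List.Relation.Unary.Unique.Propositional.Properties using (allFin⁺; filter⁺; map⁺; ++⁺; upTo⁺)
open import Data.List.Relation.Unary.Linked as Linked using (Linked; []; [-]; _∷_)
open import Data.List.Relation.Unary.Linked.Properties as Linked using (Linked⇒All)
open import Data.List.Relation.Binary.Subset.Propositional using (_⊆_)
open import Data.List.Relation.Binary.Disjoint.Propositional using (Disjoint)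
open import Data.List.Relation.Binary.Permutation.Propositional using (_↭_; ↭-sym; ↭-trans; ↭-reflexive)
open import Data.List.Relation.Binary.Permutation.Propositional.Properties using (∈-resp-↭; ↭-length; ↭-map-inv)
open import Data.Maybe as Maybe using (just)
open import Data.Product using (Σ; ∃; _×_; _,_; proj₁; proj₂)
open import Data.Sum using (_⊎_; inj₁; inj₂; [_,_])
open import Function using (_∘_)
open import Function.Bundles using (_⇔_; mk⇔)
open import Relation.Binary.Definitions using (tri<; tri≈; tri>)
open import Relation.Binary.PropositionalEquality hiding ([_])
open import Relation.Nullary using (¬_; Dec; yes; no; contradiction)
open import Relation.Nullary.Decidable using (_×-dec_)

private
  variable
    a b : Level
    A : Set a
    B : Set b

∈-─⁺ : ∀ {x y : A} {xs} (x∈xs : x ∈ xs) → y ∈ xs → x ≢ y → y ∈ (xs ─ x∈xs)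
∈-─⁺ (here refl)  (here refl)  x≢y = contradiction refl x≢y
∈-─⁺ (here _)     (there y∈xs) _   = y∈xs
∈-─⁺ (there _)    (here refl)  _   = here refl
∈-─⁺ (there x∈xs) (there y∈xs) x≢y = there (∈-─⁺ x∈xs y∈xs x≢y)

injectiveOn⇒length≤ : (f : A → B) {xs : List A} {ys : List B} → Unique xs →
                      (∀ {x} → x ∈ xs → f x ∈ ys) →
                      (∀ {x y} → x ∈ xs → y ∈ xs → f x ≡ f y → x ≡ y) →
                      length xs ≤ length ys
injectiveOn⇒length≤ f {[]}     _                  _    _   = z≤n
injectiveOn⇒length≤ f {x ∷ xs} {ys} (x∉xs ∷ xs!) into inj = begin
  suc (length xs)           ≤⟨ s≤s (injectiveOn⇒length≤ f xs! into′ (λ p q → inj (there p) (there q))) ⟩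
  suc (length (ys ─ fx∈ys)) ≡⟨ length-removeAt′ ys (index fx∈ys) ⟨
  length ys                 ∎
  where
  open ≤-Reasoning
  fx∈ys : f x ∈ ys
  fx∈ys = into (here refl)
  into′ : ∀ {y} → y ∈ xs → f y ∈ (ys ─ fx∈ys)
  into′ y∈xs = ∈-─⁺ fx∈ys (into (there y∈xs))
    (λ fx≡fy → All.lookup x∉xs y∈xs (inj (here refl) (there y∈xs) fx≡fy))

unique∧⊆⇒length≤ : ∀ {xs ys : List A} → Unique xs → xs ⊆ ys → length xs ≤ length ys
unique∧⊆⇒length≤ xs! xs⊆ys = injectiveOn⇒length≤ (λ x → x) xs! xs⊆ys (λ _ _ x≡y → x≡y)

minL-≤ : ∀ {y xs} → y ∈ xs → minL xs ≤ y
minL-≤ {xs = x ∷ xs} y∈ = foldr-preservesᵒ (λ a b → [ m≤n⇒m⊓o≤n b , m≤n⇒o⊓m≤n a ]) x xs (split y∈)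
  where
  split : ∀ {y} → y ∈ x ∷ xs → x ≤ y ⊎ Any (_≤ y) xs
  split (here y≡x)   = inj₁ (≤-reflexive (sym y≡x))
  split (there y∈xs) = inj₂ (Any.map (λ y≡z → ≤-reflexive (sym y≡z)) y∈xs)

≤-maxL : ∀ {y xs} → y ∈ xs → y ≤ maxL xs
≤-maxL {xs = xs} y∈ = foldr-preservesᵒ (λ a b → [ m≤n⇒m≤n⊔o b , m≤n⇒m≤o⊔n a ]) 0 xs
  (inj₂ (Any.map ≤-reflexive y∈))

minL-∈ : ∀ {y xs} → y ∈ xs → minL xs ∈ xs
minL-∈ {xs = x ∷ xs} _ with foldr-selective ⊓-sel x xs
... | inj₁ min≡x = here min≡x
... | inj₂ min∈xs = there min∈xs

maxL-∈ : ∀ {y xs} → y ∈ xs → maxL xs ∈ xs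
maxL-∈ {y} {xs} y∈ with foldr-selective ⊔-sel 0 xs
... | inj₂ max∈xs = max∈xs
... | inj₁ max≡0 = subst (_∈ xs) (trans (n≤0⇒n≡0 (subst (y ≤_) max≡0 (≤-maxL y∈))) (sym max≡0)) y∈

Steps≤1 : List ℕ → Set
Steps≤1 = Linked (λ a b → b ≤ suc a)

LastFits : ℕ → List ℕ → Set
LastFits n ds = ∀ {d} → last ds ≡ just d → length ds + d ≤ n

sorted∋0⇒starts-0 : ∀ {xs} → Linked _≤_ xs → 0 ∈ xs → ∃ λ rest → xs ≡ 0 ∷ rest
sorted∋0⇒starts-0 {a ∷ xs} sorted 0∈
  with refl ← n≤0⇒n≡0 (All.lookup (Linked⇒All ≤-trans ≤-refl sorted) 0∈) = xs , refl

sorted-pred-closed⇒next≤suc : ∀ {a b xs} → Linked _≤_ (b ∷ xs) →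
                              (∀ {v} → suc v ≡ b → v ≤ a ⊎ v ∈ b ∷ xs) → b ≤ suc a
sorted-pred-closed⇒next≤suc {b = zero}  _      _      = z≤n
sorted-pred-closed⇒next≤suc {b = suc v} sorted closed with closed refl
... | inj₁ v≤a = s≤s v≤a
... | inj₂ v∈  = contradiction (All.lookup (Linked⇒All ≤-trans ≤-refl sorted) v∈) 1+n≰n

sorted-pred-closed⇒steps≤1 : ∀ {xs} → Linked _≤_ xs → (∀ {v} → suc v ∈ xs → v ∈ xs) → Steps≤1 xs
sorted-pred-closed⇒steps≤1 {[]}     _      _      = []
sorted-pred-closed⇒steps≤1 {a ∷ xs} sorted closed = go sorted closed-after-a
  where
  closed-after-a : ∀ {v} → suc v ∈ xs → v ≤ a ⊎ v ∈ xs
  closed-after-a 1+v∈xs with closed (there 1+v∈xs)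
  ... | here v≡a    = inj₁ (≤-reflexive v≡a)
  ... | there v∈xs = inj₂ v∈xs

  go : ∀ {a xs} → Linked _≤_ (a ∷ xs) → (∀ {v} → suc v ∈ xs → v ≤ a ⊎ v ∈ xs) → Steps≤1 (a ∷ xs)
  go {xs = []}     _              _      = [-]
  go {a} {b ∷ xs} (a≤b ∷ sorted) closed =
    sorted-pred-closed⇒next≤suc sorted (λ { refl → closed (here refl) }) ∷ go sorted closed′
    where
    closed′ : ∀ {v} → suc v ∈ xs → v ≤ b ⊎ v ∈ xs
    closed′ 1+v∈xs with closed (there 1+v∈xs)
    ... | inj₁ v≤a          = inj₁ (≤-trans v≤a a≤b)
    ... | inj₂ (here v≡b)   = inj₁ (≤-reflexive v≡b)
    ... | inj₂ (there v∈xs) = inj₂ v∈xs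

module _ (f : ℕ → ℕ) {P : ℕ → Set} (f-zero : f 0 ≡ 0)
         (f-suc : ∀ x → f (suc x) ≤ f x ⊎ P x × f (suc x) ≤ suc (f x)) where

  values-below-attained : ∀ x {v} → v < f x → ∃ λ y → P y × f y ≡ v
  values-below-attained zero    v<f0 = contradiction (subst (_ <_) f-zero v<f0) n≮0
  values-below-attained (suc x) {v} v<f with v <? f x | f-suc x
  ... | yes v<fx | _                = values-below-attained x v<fx
  ... | no  v≮fx | inj₁ f[1+x]≤fx   = contradiction (<-≤-trans v<f f[1+x]≤fx) v≮fx
  ... | no  v≮fx | inj₂ (Px , f[1+x]≤1+fx) =
    x , Px , ≤-antisym (≮⇒≥ v≮fx) (s≤s⁻¹ (≤-trans v<f f[1+x]≤1+fx))

module Blocks {n} (π : Partition n) where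

  private
    K = k π
    variable
      j j′ : Fin K
      e : Fin n
      x : ℕ

  ∈-elems : block π e ≡ j → toℕ e ∈ elems π j
  ∈-elems {e} e∈j = ∈-map⁺ toℕ (∈-filter⁺ (λ x → block π x Fin.≟ _) (∈-allFin e) e∈j)

  ∈-elems⁻ : ∀ {x} → x ∈ elems π j → ∃ λ e → block π e ≡ j × toℕ e ≡ x
  ∈-elems⁻ x∈ with e , e∈all , x≡e ← ∈-map⁻ toℕ x∈ =
    e , proj₂ (∈-filter⁻ (λ x → block π x Fin.≟ _) {xs = allFin n} e∈all) , sym x≡e

  minB-≤ : block π e ≡ j → minB π j ≤ toℕ e
  minB-≤ e∈j = minL-≤ (∈-elems e∈j)

  ≤-maxB : block π e ≡ j → toℕ e ≤ maxB π j
  ≤-maxB e∈j = ≤-maxL (∈-elems e∈j)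

  block-nonempty : ∀ j → ∃ λ e → block π e ≡ j
  block-nonempty j with e , onto ← surjective π j = e , onto refl

  minB-attained : ∀ j → ∃ λ e → block π e ≡ j × toℕ e ≡ minB π j
  minB-attained j with e , e∈j ← block-nonempty j = ∈-elems⁻ (minL-∈ (∈-elems e∈j))

  maxB-attained : ∀ j → ∃ λ e → block π e ≡ j × toℕ e ≡ maxB π j
  maxB-attained j with e , e∈j ← block-nonempty j = ∈-elems⁻ (maxL-∈ (∈-elems e∈j))

  minElem maxElem : Fin K → Fin n
  minElem j = proj₁ (minB-attained j)
  maxElem j = proj₁ (maxB-attained j)

  block-minElem : ∀ j → block π (minElem j) ≡ j
  block-minElem j = proj₁ (proj₂ (minB-attained j))

  block-maxElem : ∀ j → block π (maxElem j) ≡ j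
  block-maxElem j = proj₁ (proj₂ (maxB-attained j))

  toℕ-minElem : ∀ j → toℕ (minElem j) ≡ minB π j
  toℕ-minElem j = proj₂ (proj₂ (minB-attained j))

  toℕ-maxElem : ∀ j → toℕ (maxElem j) ≡ maxB π j
  toℕ-maxElem j = proj₂ (proj₂ (maxB-attained j))

  minElem-injective : minElem j ≡ minElem j′ → j ≡ j′
  minElem-injective {j} {j′} eq = trans (sym (block-minElem j)) (trans (cong (block π) eq) (block-minElem j′))

  maxElem-injective : maxElem j ≡ maxElem j′ → j ≡ j′
  maxElem-injective {j} {j′} eq = trans (sym (block-maxElem j)) (trans (cong (block π) eq) (block-maxElem j′))

  minElem≡maxElem⇒minB≡maxB : minElem j ≡ maxElem j′ → minB π j′ ≡ maxB π j′
  minElem≡maxElem⇒minB≡maxB {j} {j′} min≡max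
    with refl ← trans (sym (block-minElem j)) (trans (cong (block π) min≡max) (block-maxElem j′))
    = trans (sym (toℕ-minElem j)) (trans (cong toℕ min≡max) (toℕ-maxElem j))

  minB≤maxB : ∀ j → minB π j ≤ maxB π j
  minB≤maxB j = subst (_≤ maxB π j) (toℕ-minElem j) (≤-maxB (block-minElem j))

  minB-injective : minB π j ≡ minB π j′ → j ≡ j′
  minB-injective {j} {j′} min≡min =
    minElem-injective (toℕ-injective (trans (toℕ-minElem j) (trans min≡min (sym (toℕ-minElem j′)))))

  Spans : Fin K → ℕ → Set
  Spans j x = minB π j < x × x ≤ maxB π j

  spans? : ∀ x j → Dec (Spans j x)
  spans? x j = (minB π j <? x) ×-dec (x ≤? maxB π j)

  spanning : ℕ → List (Fin K)
  spanning x = filter (spans? x) (allFin K)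

  depth : ℕ → ℕ
  depth x = length (spanning x)

  ∈-spanning : Spans j x → j ∈ spanning x
  ∈-spanning = ∈-filter⁺ (spans? _) (∈-allFin _)

  ∈-spanning⁻ : j ∈ spanning x → Spans j x
  ∈-spanning⁻ = proj₂ ∘ ∈-filter⁻ (spans? _) {xs = allFin K}

  spanning-unique : ∀ x → Unique (spanning x)
  spanning-unique x = filter⁺ (spans? x) (allFin⁺ K)

  lowerDeg≡depth : ∀ i → lowerDeg π i ≡ depth (minB π i)
  lowerDeg≡depth i = cong length (filter-≐ _ _ (to , from) (allFin K))
    where
    to : ∀ {j} → _ → Spans j (minB π i)
    to (j<i , _ , j≮i) = j<i , ≮⇒≥ j≮i
    from : ∀ {j} → Spans j (minB π i) → _
    from (j<i , i≤j) = j<i , ≤⇒≯ (<⇒≤ (<-≤-trans j<i (minB≤maxB i))) , ≤⇒≯ i≤j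

  depth-zero : depth 0 ≡ 0
  depth-zero = cong length (filter-none (spans? 0) (All.universal (λ _ (j<0 , _) → n≮0 j<0) (allFin K)))

  spanning-suc : j ∈ spanning (suc x) → minB π j ≡ x ⊎ j ∈ spanning x
  spanning-suc j∈ with j<1+x , 1+x≤j ← ∈-spanning⁻ j∈ with m≤n⇒m<n∨m≡n (s≤s⁻¹ j<1+x)
  ... | inj₁ j<x = inj₂ (∈-spanning (j<x , <⇒≤ 1+x≤j))
  ... | inj₂ j≡x = inj₁ j≡x

  depth-suc : ∀ x → depth (suc x) ≤ depth x ⊎ (∃ λ j → minB π j ≡ x) × depth (suc x) ≤ suc (depth x)
  depth-suc x with any? (λ j → minB π j ≟ x)
  ... | no ∄j = inj₁ (unique∧⊆⇒length≤ (spanning-unique (suc x)) ⊆spanning)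
    where
    ⊆spanning : spanning (suc x) ⊆ spanning x
    ⊆spanning j∈ with spanning-suc j∈
    ... | inj₁ j≡x = contradiction (_ , j≡x) ∄j
    ... | inj₂ j∈′ = j∈′
  ... | yes (j₀ , j₀≡x) = inj₂ ((j₀ , j₀≡x) , unique∧⊆⇒length≤ (spanning-unique (suc x)) ⊆j₀∷spanning)
    where
    ⊆j₀∷spanning : spanning (suc x) ⊆ j₀ ∷ spanning x
    ⊆j₀∷spanning j∈ with spanning-suc j∈
    ... | inj₁ j≡x = here (minB-injective (trans j≡x (sym j₀≡x)))
    ... | inj₂ j∈′ = there j∈′

  lowerDeg-zero : 1 ≤ n → ∃ λ j → lowerDeg π j ≡ 0
  lowerDeg-zero (s≤s z≤n) = block π Fin.zero , (begin
    lowerDeg π (block π Fin.zero)   ≡⟨ lowerDeg≡depth _ ⟩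
    depth (minB π (block π Fin.zero)) ≡⟨ cong depth (n≤0⇒n≡0 (minB-≤ refl)) ⟩
    depth 0                         ≡⟨ depth-zero ⟩
    0                               ∎)
    where open ≡-Reasoning

  lowerDeg-pred : ∀ i {v} → lowerDeg π i ≡ suc v → ∃ λ j → lowerDeg π j ≡ v
  lowerDeg-pred i {v} deg≡1+v
    with y , (j , j≡y) , depth≡v ← values-below-attained depth depth-zero depth-suc (minB π i)
           (subst (v <_) (trans (sym deg≡1+v) (lowerDeg≡depth i)) (n<1+n v))
    = j , trans (lowerDeg≡depth j) (trans (cong depth j≡y) depth≡v)

  k+depth≤n : ∀ x → K + depth x ≤ n
  k+depth≤n x = begin
    K + depth x               ≡⟨ cong₂ _+_ length-mins (length-map maxElem (spanning x)) ⟨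
    length mins + length maxs ≡⟨ length-++ mins ⟨
    length (mins ++ maxs)     ≤⟨ unique∧⊆⇒length≤ extremes-unique (λ _ → ∈-allFin _) ⟩
    length (allFin n)         ≡⟨ length-tabulate (λ e → e) ⟩
    n                         ∎
    where
    open ≤-Reasoning
    mins maxs : List (Fin n)
    mins = map minElem (allFin K)
    maxs = map maxElem (spanning x)
    length-mins : length mins ≡ K
    length-mins = trans (length-map minElem (allFin K)) (length-tabulate (λ j → j))
    extremes-disjoint : Disjoint mins maxs
    extremes-disjoint (v∈mins , v∈maxs)
      with j , _ , refl ← ∈-map⁻ minElem v∈mins
      with j′ , j′∈ , min≡max ← ∈-map⁻ maxElem v∈maxs
      with j′<x , x≤j′ ← ∈-spanning⁻ j′∈
      = <⇒≢ (<-≤-trans j′<x x≤j′) (minElem≡maxElem⇒minB≡maxB min≡max)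
    extremes-unique : Unique (mins ++ maxs)
    extremes-unique = ++⁺ (map⁺ minElem-injective (allFin⁺ K))
                          (map⁺ maxElem-injective (spanning-unique x))
                          extremes-disjoint

  k+lowerDeg≤n : ∀ i → K + lowerDeg π i ≤ n
  k+lowerDeg≤n i = subst (λ d → K + d ≤ n) (sym (lowerDeg≡depth i)) (k+depth≤n (minB π i))

last-∈ : ∀ {xs : List A} {x} → last xs ≡ just x → x ∈ xs
last-∈ {xs = _ ∷ []}     refl = here refl
last-∈ {xs = _ ∷ _ ∷ xs} eq   = there (last-∈ {xs = _ ∷ xs} eq)

sorted-lowerDegs⇒conditions : ∀ {n} → 1 ≤ n → (π : Partition n) → ∀ {ds} → Linked _≤_ ds →
                              map (lowerDeg π) (allFin (k π)) ↭ ds →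
                              (∃ λ rest → ds ≡ 0 ∷ rest) × Steps≤1 ds × LastFits n ds
sorted-lowerDegs⇒conditions {n} 1≤n π {ds} sorted degrees↭ds =
  sorted∋0⇒starts-0 sorted 0∈ds , sorted-pred-closed⇒steps≤1 sorted pred-closed , bounded
  where
  open Blocks π
  degree-∈ : ∀ j → lowerDeg π j ∈ ds
  degree-∈ j = ∈-resp-↭ degrees↭ds (∈-map⁺ (lowerDeg π) (∈-allFin j))
  ∈-degree : ∀ {d} → d ∈ ds → ∃ λ j → lowerDeg π j ≡ d
  ∈-degree d∈ with j , _ , d≡ ← ∈-map⁻ (lowerDeg π) (∈-resp-↭ (↭-sym degrees↭ds) d∈) = j , sym d≡
  0∈ds : 0 ∈ ds
  0∈ds with j , deg≡0 ← lowerDeg-zero 1≤n = subst (_∈ ds) deg≡0 (degree-∈ j)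
  pred-closed : ∀ {v} → suc v ∈ ds → v ∈ ds
  pred-closed 1+v∈ =
    let j , deg≡1+v = ∈-degree 1+v∈
        j′ , deg≡v  = lowerDeg-pred j deg≡1+v
    in subst (_∈ ds) deg≡v (degree-∈ j′)
  length-ds : length ds ≡ k π
  length-ds = trans (sym (↭-length degrees↭ds))
                    (trans (length-map (lowerDeg π) (allFin (k π))) (length-tabulate (λ j → j)))
  bounded : LastFits n ds
  bounded last≡d with j , refl ← ∈-degree (last-∈ last≡d) =
    subst (λ l → l + lowerDeg π j ≤ n) (sym length-ds) (k+lowerDeg≤n j)

-- Here k is the index of the last block and w t the desired lower degree of block t.
module Construction (n k : ℕ) (w : ℕ → ℕ) (w-zero : w 0 ≡ 0)
                    (w-mono : ∀ {t} → t < k → w t ≤ w (suc t))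
                    (w-step : ∀ {t} → t < k → w (suc t) ≤ suc (w t))
                    (room : suc k + w k ≤ n) where

  w-monotone : ∀ {s} t → s ≤ t → t ≤ k → w s ≤ w t
  w-monotone zero    z≤n _ = ≤-refl
  w-monotone (suc t) s≤1+t 1+t≤k with m≤n⇒m<n∨m≡n s≤1+t
  ... | inj₂ refl = ≤-refl
  ... | inj₁ s<1+t = ≤-trans (w-monotone t (s≤s⁻¹ s<1+t) (<⇒≤ 1+t≤k)) (w-mono 1+t≤k)

  Jump : ℕ → Set
  Jump t = t < k × w (suc t) ≡ suc (w t)

  jump? : ∀ t → Dec (Jump t)
  jump? t = (t <? k) ×-dec (w (suc t) ≟ suc (w t))

  w-jump-< : ∀ {s t} → Jump s → s < t → t ≤ k → w s < w t
  w-jump-< {s} {t} (_ , s-jumps) s<t t≤k = begin-strict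
    w s       <⟨ n<1+n (w s) ⟩
    suc (w s) ≡⟨ s-jumps ⟨
    w (suc s) ≤⟨ w-monotone t s<t t≤k ⟩
    w t       ∎
    where open ≤-Reasoning

  jump-injective : ∀ {s t} → Jump s → Jump t → w s ≡ w t → s ≡ t
  jump-injective {s} {t} s-jumps t-jumps ws≡wt with <-cmp s t
  ... | tri< s<t _ _ = contradiction ws≡wt (<⇒≢ (w-jump-< s-jumps s<t (<⇒≤ (proj₁ t-jumps))))
  ... | tri≈ _ s≡t _ = s≡t
  ... | tri> _ _ t<s = contradiction (sym ws≡wt) (<⇒≢ (w-jump-< t-jumps t<s (<⇒≤ (proj₁ s-jumps))))

  -- the largest t′ ≤ t with w t′ ≤ r, which exists since w 0 ≡ 0
  lastBelow : ℕ → ℕ → ℕ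
  lastBelow r zero = zero
  lastBelow r (suc t) with w (suc t) ≤? r
  ... | yes _ = suc t
  ... | no  _ = lastBelow r t

  lastBelow-≤ : ∀ r t → lastBelow r t ≤ t
  lastBelow-≤ r zero = z≤n
  lastBelow-≤ r (suc t) with w (suc t) ≤? r
  ... | yes _ = ≤-refl
  ... | no  _ = m≤n⇒m≤1+n (lastBelow-≤ r t)

  w-lastBelow : ∀ r t → w (lastBelow r t) ≤ r
  w-lastBelow r zero = subst (_≤ r) (sym w-zero) z≤n
  w-lastBelow r (suc t) with w (suc t) ≤? r
  ... | yes w≤r = w≤r
  ... | no  _   = w-lastBelow r t

  lastBelow-maximal : ∀ r t {s} → lastBelow r t < s → s ≤ t → r < w s
  lastBelow-maximal r zero    lb<s s≤0 = contradiction (<-≤-trans lb<s s≤0) n≮0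
  lastBelow-maximal r (suc t) lb<s s≤1+t with w (suc t) ≤? r
  ... | yes _ = contradiction (<-≤-trans lb<s s≤1+t) (<-irrefl refl)
  ... | no w≰r with m≤n⇒m<n∨m≡n s≤1+t
  ...   | inj₁ s<1+t = lastBelow-maximal r t lb<s (s≤s⁻¹ s<1+t)
  ...   | inj₂ refl  = ≰⇒> w≰r

  lastBelow-jump : ∀ {t} → Jump t → lastBelow (w t) k ≡ t
  lastBelow-jump {t} t-jumps@(t<k , _) = ≤-antisym (≮⇒≥ t≮lb) (≮⇒≥ lb≮t)
    where
    t≮lb : ¬ t < lastBelow (w t) k
    t≮lb t<lb = <⇒≱ (w-jump-< t-jumps t<lb (lastBelow-≤ (w t) k)) (w-lastBelow (w t) k)
    lb≮t : ¬ lastBelow (w t) k < t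
    lb≮t lb<t = <-irrefl refl (lastBelow-maximal (w t) k lb<t (<⇒≤ t<k))

  jump-at-lastBelow : ∀ {r} → r < w k → Jump (lastBelow r k) × w (lastBelow r k) ≡ r
  jump-at-lastBelow {r} r<wk with m≤n⇒m<n∨m≡n (lastBelow-≤ r k)
  ... | inj₂ lb≡k = contradiction (subst (λ t → w t ≤ r) lb≡k (w-lastBelow r k)) (<⇒≱ r<wk)
  ... | inj₁ lb<k = (lb<k , jumps) , wt≡r
    where
    r<w[1+t] : r < w (suc (lastBelow r k))
    r<w[1+t] = lastBelow-maximal r k ≤-refl lb<k
    wt≡r : w (lastBelow r k) ≡ r
    wt≡r = ≤-antisym (w-lastBelow r k) (s≤s⁻¹ (≤-trans r<w[1+t] (w-step lb<k)))
    jumps : w (suc (lastBelow r k)) ≡ suc (w (lastBelow r k))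
    jumps = ≤-antisym (w-step lb<k) (subst (λ x → suc x ≤ w (suc (lastBelow r k))) (sym wt≡r) r<w[1+t])

  blockOf : ℕ → ℕ
  blockOf x with x <? suc k
  ... | yes _ = x
  ... | no  _ = lastBelow (x ∸ suc k) k

  blockOf<1+k : ∀ x → blockOf x < suc k
  blockOf<1+k x with x <? suc k
  ... | yes x<1+k = x<1+k
  ... | no  _     = s≤s (lastBelow-≤ (x ∸ suc k) k)

  blockOf-≤ : ∀ x → blockOf x ≤ x
  blockOf-≤ x with x <? suc k
  ... | yes _   = ≤-refl
  ... | no  x≮K = ≤-trans (lastBelow-≤ (x ∸ suc k) k) (≤-trans (n≤1+n k) (≮⇒≥ x≮K))

  blockOf-start : ∀ {x} → x < suc k → blockOf x ≡ x
  blockOf-start {x} x<K with x <? suc k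
  ... | yes _   = refl
  ... | no  x≮K = contradiction x<K x≮K

  blockOf-tail : ∀ r → blockOf (suc k + r) ≡ lastBelow r k
  blockOf-tail r with suc k + r <? suc k
  ... | yes K+r<K = contradiction (m≤m+n (suc k) r) (<⇒≱ K+r<K)
  ... | no  _     = cong (λ x → lastBelow x k) (m+n∸m≡n (suc k) r)

  blockOf≡nonjump⇒≡ : ∀ {x t} → t < k → ¬ Jump t → blockOf x ≡ t → x ≡ t
  blockOf≡nonjump⇒≡ {x} {t} t<k no-jump x↦t with x <? suc k
  ... | yes _ = x↦t
  ... | no  _ = contradiction (t<k , ≤-antisym (w-step t<k) (≤-trans (s≤s wt≤r) r<w[1+t])) no-jump
    where
    r = x ∸ suc k
    wt≤r : w t ≤ r
    wt≤r = subst (λ s → w s ≤ r) x↦t (w-lastBelow r k)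
    r<w[1+t] : r < w (suc t)
    r<w[1+t] = lastBelow-maximal r k (s≤s (≤-reflexive x↦t)) t<k

  1+k≤n : suc k ≤ n
  1+k≤n = ≤-trans (m≤m+n (suc k) (w k)) room

  blockFin : Fin n → Fin (suc k)
  blockFin e = fromℕ< (blockOf<1+k (toℕ e))

  start : Fin (suc k) → Fin n
  start j = fromℕ< (<-≤-trans (toℕ<n j) 1+k≤n)

  toℕ-blockFin : ∀ e → toℕ (blockFin e) ≡ blockOf (toℕ e)
  toℕ-blockFin e = toℕ-fromℕ< (blockOf<1+k (toℕ e))

  toℕ-start : ∀ j → toℕ (start j) ≡ toℕ j
  toℕ-start j = toℕ-fromℕ< (<-≤-trans (toℕ<n j) 1+k≤n)

  block-start : ∀ j → blockFin (start j) ≡ j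
  block-start j = toℕ-injective (begin
    toℕ (blockFin (start j)) ≡⟨ toℕ-blockFin (start j) ⟩
    blockOf (toℕ (start j))  ≡⟨ cong blockOf (toℕ-start j) ⟩
    blockOf (toℕ j)          ≡⟨ blockOf-start (toℕ<n j) ⟩
    toℕ j                    ∎)
    where open ≡-Reasoning

  partition : Partition n
  partition = record { k = suc k ; block = blockFin ; surjective = λ j → start j , λ { refl → block-start j } }

  open Blocks partition

  blockFin≡⇒blockOf≡ : ∀ e {j} → blockFin e ≡ j → blockOf (toℕ e) ≡ toℕ j
  blockFin≡⇒blockOf≡ e e↦j = trans (sym (toℕ-blockFin e)) (cong toℕ e↦j)

  minB≡toℕ : ∀ j → minB partition j ≡ toℕ j
  minB≡toℕ j = ≤-antisym
    (subst (minB partition j ≤_) (toℕ-start j) (minB-≤ (block-start j)))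
    (begin
      toℕ j                   ≡⟨ blockFin≡⇒blockOf≡ (minElem j) (block-minElem j) ⟨
      blockOf (toℕ (minElem j)) ≤⟨ blockOf-≤ _ ⟩
      toℕ (minElem j)         ≡⟨ toℕ-minElem j ⟩
      minB partition j        ∎)
    where open ≤-Reasoning

  jump⇒1+k≤maxB : ∀ {j} → Jump (toℕ j) → suc k ≤ maxB partition j
  jump⇒1+k≤maxB {j} j-jumps@(j<k , _) = begin
    suc k                    ≤⟨ m≤m+n (suc k) (w (toℕ j)) ⟩
    suc k + w (toℕ j)        ≡⟨ toℕ-fromℕ< tail<n ⟨
    toℕ (fromℕ< tail<n)      ≤⟨ ≤-maxB tail↦j ⟩
    maxB partition j         ∎
    where
    open ≤-Reasoning
    tail<n : suc k + w (toℕ j) < n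
    tail<n = <-≤-trans (+-monoʳ-< (suc k) (w-jump-< j-jumps j<k ≤-refl)) room
    tail↦j : blockFin (fromℕ< tail<n) ≡ j
    tail↦j = toℕ-injective (begin-equality
      toℕ (blockFin (fromℕ< tail<n))  ≡⟨ toℕ-blockFin (fromℕ< tail<n) ⟩
      blockOf (toℕ (fromℕ< tail<n))   ≡⟨ cong blockOf (toℕ-fromℕ< tail<n) ⟩
      blockOf (suc k + w (toℕ j))     ≡⟨ blockOf-tail (w (toℕ j)) ⟩
      lastBelow (w (toℕ j)) k         ≡⟨ lastBelow-jump j-jumps ⟩
      toℕ j                           ∎)

  nonjump⇒maxB≡toℕ : ∀ {j} → toℕ j < k → ¬ Jump (toℕ j) → maxB partition j ≡ toℕ j
  nonjump⇒maxB≡toℕ {j} j<k no-jump =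
    trans (sym (toℕ-maxElem j)) (blockOf≡nonjump⇒≡ j<k no-jump (blockFin≡⇒blockOf≡ (maxElem j) (block-maxElem j)))

  spanning⇒jump : ∀ i {j} → j ∈ spanning (toℕ i) → toℕ j < toℕ i × Jump (toℕ j)
  spanning⇒jump i {j} j∈ = j<i , jumps
    where
    spans = ∈-spanning⁻ j∈
    j<i : toℕ j < toℕ i
    j<i = subst (_< toℕ i) (minB≡toℕ j) (proj₁ spans)
    jumps : Jump (toℕ j)
    jumps with jump? (toℕ j)
    ... | yes j-jumps = j-jumps
    ... | no  no-jump = contradiction
      (≤-trans (proj₂ spans) (≤-reflexive (nonjump⇒maxB≡toℕ (<-≤-trans j<i (s≤s⁻¹ (toℕ<n i))) no-jump)))
      (<⇒≱ j<i)

  jump⇒spanning : ∀ i {j} → toℕ j < toℕ i → Jump (toℕ j) → j ∈ spanning (toℕ i)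
  jump⇒spanning i {j} j<i j-jumps =
    ∈-spanning (subst (_< toℕ i) (sym (minB≡toℕ j)) j<i , <⇒≤ (<-≤-trans (toℕ<n i) (jump⇒1+k≤maxB j-jumps)))

  lastBlock : ℕ → Fin (suc k)
  lastBlock r = fromℕ< (s≤s (lastBelow-≤ r k))

  toℕ-lastBlock : ∀ r → toℕ (lastBlock r) ≡ lastBelow r k
  toℕ-lastBlock r = toℕ-fromℕ< (s≤s (lastBelow-≤ r k))

  -- The blocks spanning i are the jumps of w before i; t ↦ w t and r ↦ lastBelow r k
  -- are mutually inverse injections between them and the values below w i.
  depth≡w : ∀ i → depth (toℕ i) ≡ w (toℕ i)
  depth≡w i = ≤-antisym depth≤w w≤depth
    where
    i≤k : toℕ i ≤ k
    i≤k = s≤s⁻¹ (toℕ<n i)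

    below-w : ∀ {r} → r ∈ upTo (w (toℕ i)) → r < w k
    below-w r∈ = <-≤-trans (∈-upTo⁻ r∈) (w-monotone k i≤k ≤-refl)

    depth≤w : depth (toℕ i) ≤ w (toℕ i)
    depth≤w = begin
      depth (toℕ i)             ≤⟨ injectiveOn⇒length≤ (w ∘ toℕ) (spanning-unique (toℕ i)) into inj ⟩
      length (upTo (w (toℕ i))) ≡⟨ length-upTo (w (toℕ i)) ⟩
      w (toℕ i)                 ∎
      where
      open ≤-Reasoning
      into : ∀ {j} → j ∈ spanning (toℕ i) → w (toℕ j) ∈ upTo (w (toℕ i))
      into j∈ with j<i , j-jumps ← spanning⇒jump i j∈ = ∈-upTo⁺ (w-jump-< j-jumps j<i i≤k)
      inj : ∀ {j j′} → j ∈ spanning (toℕ i) → j′ ∈ spanning (toℕ i) → w (toℕ j) ≡ w (toℕ j′) → j ≡ j′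
      inj j∈ j′∈ wj≡wj′ =
        toℕ-injective (jump-injective (proj₂ (spanning⇒jump i j∈)) (proj₂ (spanning⇒jump i j′∈)) wj≡wj′)

    w≤depth : w (toℕ i) ≤ depth (toℕ i)
    w≤depth = begin
      w (toℕ i)                 ≡⟨ length-upTo (w (toℕ i)) ⟨
      length (upTo (w (toℕ i))) ≤⟨ injectiveOn⇒length≤ lastBlock (upTo⁺ (w (toℕ i))) into inj ⟩
      depth (toℕ i)             ∎
      where
      open ≤-Reasoning
      into : ∀ {r} → r ∈ upTo (w (toℕ i)) → lastBlock r ∈ spanning (toℕ i)
      into {r} r∈ with jumps , w-lb≡r ← jump-at-lastBelow (below-w r∈) =
        jump⇒spanning i (subst (_< toℕ i) (sym (toℕ-lastBlock r)) lb<i)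
                      (subst Jump (sym (toℕ-lastBlock r)) jumps)
        where
        lb<i : lastBelow r k < toℕ i
        lb<i = ≰⇒> λ i≤lb → <⇒≱ (∈-upTo⁻ r∈)
          (subst (w (toℕ i) ≤_) w-lb≡r (w-monotone (lastBelow r k) i≤lb (lastBelow-≤ r k)))
      inj : ∀ {r r′} → r ∈ upTo (w (toℕ i)) → r′ ∈ upTo (w (toℕ i)) → lastBlock r ≡ lastBlock r′ → r ≡ r′
      inj {r} {r′} r∈ r′∈ lb≡lb′ = begin-equality
        r                    ≡⟨ proj₂ (jump-at-lastBelow (below-w r∈)) ⟨
        w (lastBelow r k)    ≡⟨ cong w (trans (sym (toℕ-lastBlock r)) (trans (cong toℕ lb≡lb′) (toℕ-lastBlock r′))) ⟩
        w (lastBelow r′ k)   ≡⟨ proj₂ (jump-at-lastBelow (below-w r′∈)) ⟩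
        r′                   ∎

  lowerDeg-partition : ∀ i → lowerDeg partition i ≡ w (toℕ i)
  lowerDeg-partition i = trans (lowerDeg≡depth i) (trans (cong depth (minB≡toℕ i)) (depth≡w i))

nth : List ℕ → ℕ → ℕ
nth []       _       = 0
nth (x ∷ _)  zero    = x
nth (_ ∷ xs) (suc t) = nth xs t

nth-linked : ∀ {R : ℕ → ℕ → Set} {xs t} → Linked R xs → suc t < length xs → R (nth xs t) (nth xs (suc t))
nth-linked {t = zero}  (Rxy ∷ _)    _             = Rxy
nth-linked {t = zero}  [-]          (s≤s ())
nth-linked {t = suc t} (_ ∷ linked) (s≤s 1+t<len) = nth-linked linked 1+t<len

tabulate-nth : ∀ xs → tabulate (λ (i : Fin (length xs)) → nth xs (toℕ i)) ≡ xs
tabulate-nth []       = refl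
tabulate-nth (x ∷ xs) = cong (x ∷_) (tabulate-nth xs)

last-nth : ∀ x xs → last (x ∷ xs) ≡ just (nth (x ∷ xs) (length xs))
last-nth x []       = refl
last-nth x (y ∷ xs) = last-nth y xs

conditions⇒realisable : ∀ {n} ds → Linked _≤_ (0 ∷ ds) → Steps≤1 (0 ∷ ds) → LastFits n (0 ∷ ds) →
                        Σ (Partition n) λ π → map (lowerDeg π) (allFin (k π)) ≡ 0 ∷ ds
conditions⇒realisable {n} ds sorted steps bounded = partition , (begin
    map (lowerDeg partition) (allFin (suc (length ds))) ≡⟨ map-tabulate (λ i → i) (lowerDeg partition) ⟩
    tabulate (lowerDeg partition)                        ≡⟨ tabulate-cong lowerDeg-partition ⟩
    tabulate (λ i → nth (0 ∷ ds) (toℕ i))                ≡⟨ tabulate-nth (0 ∷ ds) ⟩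
    0 ∷ ds                                               ∎)
  where
  open ≡-Reasoning
  open Construction n (length ds) (nth (0 ∷ ds)) refl
    (λ t<k → nth-linked sorted (s≤s t<k)) (λ t<k → nth-linked steps (s≤s t<k)) (bounded (last-nth 0 ds))

nonneg⇒ofℕ : ∀ {ds} → All (ofℕ 0 ℤ.≤_) ds → ∃ λ es → ds ≡ map ofℕ es
nonneg⇒ofℕ []                = [] , refl
nonneg⇒ofℕ (+≤+ _ ∷ nonneg) with es , refl ← nonneg⇒ofℕ nonneg = _ ∷ es , refl

Linked-ofℕ⁻ : ∀ {es} → Linked ℤ._≤_ (map ofℕ es) → Linked _≤_ es
Linked-ofℕ⁻ = Linked.map drop‿+≤+ ∘ Linked.map⁻

Steps≤1⇒Cond2 : ∀ {es} → Steps≤1 es → Cond2 (map ofℕ es)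
Steps≤1⇒Cond2 = Linked.map⁺ ∘ Linked.map (λ {a} {b} b≤1+a → +≤+ (subst (b ≤_) (+-comm 1 a) b≤1+a))

Cond2⇒Steps≤1 : ∀ {es} → Cond2 (map ofℕ es) → Steps≤1 es
Cond2⇒Steps≤1 = Linked.map (λ {a} {b} b≤a+1 → subst (b ≤_) (+-comm a 1) (drop‿+≤+ b≤a+1)) ∘ Linked.map⁻

LastFits⇒Cond3 : ∀ {n es} → LastFits n es → Cond3 n (map ofℕ es)
LastFits⇒Cond3 {n} {es} bounded dk last≡dk with last es | trans (sym (last-map ofℕ es)) last≡dk
... | just d | refl = +≤+ (subst (λ l → l + d ≤ n) (sym (length-map ofℕ es)) (bounded refl))

Cond3⇒LastFits : ∀ {n es} → Cond3 n (map ofℕ es) → LastFits n es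
Cond3⇒LastFits {n} {es} bounded {d} last≡d =
  subst (λ l → l + d ≤ n) (length-map ofℕ es)
        (drop‿+≤+ (bounded (ofℕ d) (trans (last-map ofℕ es) (cong (Maybe.map ofℕ) last≡d))))

conditions⇒Cond123 : ∀ {n es} → (∃ λ rest → es ≡ 0 ∷ rest) × Steps≤1 es × LastFits n es →
                 Linked ℤ._≤_ (map ofℕ es) →
                 Cond1 (map ofℕ es) × Cond2 (map ofℕ es) × Cond3 n (map ofℕ es)
conditions⇒Cond123 ((rest , refl) , steps , bounded) sorted =
  ((map ofℕ rest , refl) , sorted) , Steps≤1⇒Cond2 steps , LastFits⇒Cond3 {es = 0 ∷ rest} bounded

realisation⇒IsD₁ : ∀ {n es} → Linked ℤ._≤_ (map ofℕ es) →
                   Σ (Partition n) (λ π → map (lowerDeg π) (allFin (k π)) ≡ es) →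
                   Σ (Partition n) (λ π → IsD₁ π (map ofℕ es))
realisation⇒IsD₁ sorted (π , degrees≡es) =
  π , sorted , ↭-reflexive (trans (cong (map ofℕ) (sym degrees≡es)) (sym (map-∘ (allFin (k π)))))

proposition9p6 : (n : ℕ) → 1 ≤ n → (D : List ℤ) →
    (Σ (Partition n) (λ π → IsD₁ π D)) ⇔ (Cond1 D × Cond2 D × Cond3 n D)
proposition9p6 n 1≤n D = mk⇔ sound complete
  where
  sound : Σ (Partition n) (λ π → IsD₁ π D) → Cond1 D × Cond2 D × Cond3 n D
  sound (π , sorted , D↭)
    with es , refl , degrees↭es ← ↭-map-inv ofℕ (↭-sym (↭-trans D↭ (↭-reflexive (map-∘ (allFin (k π))))))
    = conditions⇒Cond123 (sorted-lowerDegs⇒conditions 1≤n π (Linked-ofℕ⁻ sorted) degrees↭es) sorted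
  complete : Cond1 D × Cond2 D × Cond3 n D → Σ (Partition n) (λ π → IsD₁ π D)
  complete (((rest , refl) , sorted) , steps , bounded)
    with _ ∷ nonneg ← Linked⇒All ℤ.≤-trans ℤ.≤-refl sorted
    with es , refl ← nonneg⇒ofℕ nonneg
    = realisation⇒IsD₁ sorted (conditions⇒realisable es (Linked-ofℕ⁻ sorted) (Cond2⇒Steps≤1 steps)
                                                       (Cond3⇒LastFits {es = 0 ∷ es} bounded))
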